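{- Every non-symmetric amorphous association scheme (not assumed commutative a priori) is commutative, i.e. satisfies $p^k_{ij}=p^k_{ji}$ for all $i,j,k$.
   Context: Let $X$ be a finite set with $|X|\ge 2$ and $R=\{R_0,\dots,R_d\}$ a set of binary relations on $X$. $(X,R)$ is an association scheme if: (i) $R$ partitions $X\times X$ and $R_0=\{(x,x):x\in X\}$; (ii) for each $i$, the inverse $R_i^{T}=\{(y,x):(x,y)\in R_i\}$ equals $R_{i'}$ for some $i'$; (iii) for all $i,j,k$ there is an integer $p^k_{ij}$ such that for every $(x,y)\in R_k$, $|\{z:(x,z)\in R_i,(z,y)\in R_j\}|=p^k_{ij}$. It is commutative if $p^k_{ij}=p^k_{ji}$ for all $i,j,k$, and non-symmetric if some $R_i$ satisfies $R_i^T\ne R_i$. A partition $\Lambda_0,\dots,\Lambda_e$ of $\{0,\dots,d\}$ is admissible if $\Lambda_0=\{0\}$, each $\Lambda_i$ is nonempty, and each $\Lambda_i^T=\{\alpha':\alpha\in\Lambda_i\}$ equals some $\Lambda_j$. With $R_{\Lambda_i}=\bigcup_{\alpha\in\Lambda_i}R_\alpha$, if $(X,\{R_{\Lambda_i}\}_{i=0}^e)$ is an association scheme it is a fusion scheme. The scheme is amorphous if every admissible partition gives rise to a fusion scheme. -}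

module Defs where

open import Data.Nat using (ℕ; suc; _≤_)
open import Data.Fin using (Fin; zero)
open import Data.Fin.Properties using (_≟_)
open import Data.List using (length; filter)
open import Data.List using () renaming (allFin to allFinL)
open import Data.Product using (Σ; ∃; _×_; _,_)
open import Function.Bundles using (_⇔_)
open import Relation.Binary.PropositionalEquality using (_≡_)
open import Relation.Nullary using (¬_; _×-dec_)

-- The point set X is Fin n; a family of relations R_0,…,R_d partitioning
-- X × X is encoded by its "colour" function  r : X → X → Fin (suc d),
-- with (x , y) ∈ R_i  iff  r x y ≡ i.
Coloring : ℕ → ℕ → Set
Coloring n d = Fin n → Fin n → Fin (suc d)

pcount : ∀ {n d} → Coloring n d → Fin n → Fin n → Fin (suc d) → Fin (suc d) → ℕ
pcount {n} r x y i j =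
  length (filter (λ z → (r x z ≟ i) ×-dec (r z y ≟ j)) (allFinL n))

IsTranspose : ∀ {n d} → Coloring n d → Fin (suc d) → Fin (suc d) → Set
IsTranspose r α β = ∀ x y → (r y x ≡ α ⇔ r x y ≡ β)

record IsAssocScheme {n d : ℕ} (r : Coloring n d) : Set where
  field
    nonempty    : ∀ i → ∃ λ x → ∃ λ y → r x y ≡ i
    diagonal    : ∀ x y → (r x y ≡ zero ⇔ x ≡ y)
    transpose   : ∀ i → ∃ λ i' → IsTranspose r i i'
    intersection : ∀ i j k → ∃ λ p → ∀ x y → r x y ≡ k → pcount r x y i j ≡ p

Commutative : ∀ {n d} → Coloring n d → Set
Commutative r = ∀ i j k x y → r x y ≡ k → pcount r x y i j ≡ pcount r x y j i

NonSymmetric : ∀ {n d} → Coloring n d → Set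
NonSymmetric r = ∃ λ i → ¬ IsTranspose r i i

-- A partition Λ_0,…,Λ_e of {0,…,d} is given by f : Fin (suc d) → Fin (suc e),
-- Λ_j = f⁻¹(j).
Admissible : ∀ {n d e} → Coloring n d → (Fin (suc d) → Fin (suc e)) → Set
Admissible {d = d} {e = e} r f =
  (∀ α → (f α ≡ zero ⇔ α ≡ zero)) ×
  (∀ (j : Fin (suc e)) → ∃ λ α → f α ≡ j) ×
  (∀ (j : Fin (suc e)) → ∃ λ j' → ∀ β →
      (f β ≡ j' ⇔ (∃ λ α → f α ≡ j × IsTranspose r α β)))

fuse : ∀ {n d e} → Coloring n d → (Fin (suc d) → Fin (suc e)) → Coloring n e
fuse r f x y = f (r x y)

Amorphous : ∀ {n d} → Coloring n d → Set
Amorphous r = ∀ (e : ℕ) (f : Fin _ → Fin (suc e)) → Admissible r f → IsAssocScheme (fuse r f)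

module Submission where

-- Write P k a b for the intersection number p^k_{ab}, ā for the colour of the
-- transposed relation and val a = p^0_{aā} for the valency of R_a.  Besides the
-- standard identities of any scheme (p^k_{ab} = p^{k̄}_{b̄ā}, val ā = val a, the
-- rotation val c · p^c_{ab} = val a · p^a_{cb̄} and Σ_c val c · p^c_{ab} = val a · val b),
-- the proof uses a single kind of fusion: merging a non-symmetric pair {a, ā}
-- into one relation while keeping every other relation.  This partition is
-- always admissible, so amorphy makes it a scheme, and comparing path counts
-- over R_a and R_ā gives two identities (PairFusionFacts): p^a_{uv} = p^ā_{uv}
-- for u, v outside {a, ā}, and p^a_{au} + p^a_{āu} = p^ā_{au} + p^ā_{āu}.
-- Commutativity p^k_{ab} = p^k_{ba} then follows by a case analysis on how k, a, b
-- sit relative to each other's transpose classes.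

open import Defs
open import Data.Nat.Properties
  using (+-*-semiring; +-identityʳ; +-comm; *-comm; *-assoc; *-distribʳ-+;
         *-cancelˡ-≡; +-cancelʳ-≡; m≤m+n; m≤n+m; ≤-trans; <-≤-trans)
open import Algebra.Properties.Semiring.Sum +-*-semiring
  using (sum; sum-syntax; sum-cong-≗; sum-replicate-zero; ∑-distrib-+; ∑-comm;
         *-distribˡ-sum; *-distribʳ-sum)
open import Data.Empty using (⊥; ⊥-elim)
open import Data.Fin using (Fin; zero; suc; punchOut; punchIn)
open import Data.Fin.Properties
  using (_≟_; suc-injective; punchOut-cong; punchOut-injective; punchOut-punchIn; punchInᵢ≢i)
open import Data.List using (length; filter; tabulate)
open import Data.Nat using (ℕ; zero; suc; _+_; _*_; _≤_; _<_; s≤s; z≤n; >-nonZero)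
open import Data.Product using (∃; _×_; _,_; proj₁; proj₂)
open import Data.Sum using (_⊎_; inj₁; inj₂)
open import Function using (_∘_; id)
open import Function.Bundles using (_⇔_; mk⇔; Equivalence)
open import Relation.Binary.PropositionalEquality
  using (_≡_; refl; sym; trans; cong; cong₂; subst; module ≡-Reasoning)
open import Relation.Nullary using (¬_; Dec; yes; no; _×-dec_)

open Equivalence using (to; from)
open ≡-Reasoning

ind : ∀ {p} {P : Set p} → Dec P → ℕ
ind (yes _) = 1
ind (no _)  = 0

ind-cong : ∀ {p q} {P : Set p} {Q : Set q} (x : Dec P) (y : Dec Q) →
           (P → Q) → (Q → P) → ind x ≡ ind y
ind-cong (yes _) (yes _) _ _ = refl
ind-cong (yes p) (no ¬q) f _ = ⊥-elim (¬q (f p))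
ind-cong (no ¬p) (yes q) _ g = ⊥-elim (¬p (g q))
ind-cong (no _)  (no _)  _ _ = refl

ind-× : ∀ {p q} {P : Set p} {Q : Set q} (x : Dec P) (y : Dec Q) →
        ind (x ×-dec y) ≡ ind x * ind y
ind-× (yes _) (yes _) = refl
ind-× (yes _) (no _)  = refl
ind-× (no _)  (yes _) = refl
ind-× (no _)  (no _)  = refl

ind-⊎ : ∀ {p q s} {P : Set p} {Q : Set q} {R : Set s} (z : Dec R) (x : Dec P) (y : Dec Q) →
        (R → P ⊎ Q) → (P ⊎ Q → R) → (P → Q → ⊥) → ind z ≡ ind x + ind y
ind-⊎ (yes _) (yes p) (yes q) _ _ excl = ⊥-elim (excl p q)
ind-⊎ (yes _) (yes _) (no _)  _ _ _    = refl
ind-⊎ (yes _) (no _)  (yes _) _ _ _    = refl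
ind-⊎ (yes r) (no ¬p) (no ¬q) f _ _ with f r
... | inj₁ p = ⊥-elim (¬p p)
... | inj₂ q = ⊥-elim (¬q q)
ind-⊎ (no ¬r) (yes p) _       _ g _    = ⊥-elim (¬r (g (inj₁ p)))
ind-⊎ (no ¬r) (no _)  (yes q) _ g _    = ⊥-elim (¬r (g (inj₂ q)))
ind-⊎ (no _)  (no _)  (no _)  _ _ _    = refl

δ : ∀ {m} → Fin m → Fin m → ℕ
δ u v = ind (u ≟ v)

δ-sym : ∀ {m} (u v : Fin m) → δ u v ≡ δ v u
δ-sym u v = ind-cong (u ≟ v) (v ≟ u) sym sym

δ-suc : ∀ {m} (u v : Fin m) → δ (suc u) (suc v) ≡ δ u v
δ-suc u v = ind-cong (suc u ≟ suc v) (u ≟ v) suc-injective (cong suc)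

δ-≡ : ∀ {m} {u v : Fin m} → u ≡ v → δ u v ≡ 1
δ-≡ {u = u} {v} u≡v = ind-cong (u ≟ v) (yes u≡v) id id

δ-idem : ∀ {m} (u v : Fin m) → δ u v * δ u v ≡ δ u v
δ-idem u v with u ≟ v
... | yes _ = refl
... | no _  = refl

sum-δ : ∀ {m} (f : Fin m → ℕ) u → ∑[ c < m ] (δ c u * f c) ≡ f u
sum-δ {suc m} f zero =
  trans (cong₂ _+_ (+-identityʳ (f zero)) (sum-replicate-zero m)) (+-identityʳ (f zero))
sum-δ {suc m} f (suc u) =
  trans (sum-cong-≗ (λ c → cong (_* f (suc c)) (δ-suc c u))) (sum-δ (f ∘ suc) u)

sum-const : ∀ m c → ∑[ i < m ] c ≡ m * c
sum-const zero    c = refl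
sum-const (suc m) c = cong (c +_) (sum-const m c)

term≤sum : ∀ {m} (f : Fin m → ℕ) i → f i ≤ sum f
term≤sum f zero    = m≤m+n (f zero) _
term≤sum f (suc i) = ≤-trans (term≤sum (f ∘ suc) i) (m≤n+m _ (f zero))

off : ∀ {m} (a b : Fin m) → (Fin m → ℕ) → Fin m → ℕ
off a b f i with i ≟ a | i ≟ b
... | no _ | no _ = f i
... | _    | _    = 0

sum-split-pair : ∀ {m} {a b : Fin m} → ¬ a ≡ b → (f : Fin m → ℕ) →
                 sum f ≡ f a + f b + sum (off a b f)
sum-split-pair {m} {a} {b} a≢b f = begin
  sum f
    ≡⟨ sum-cong-≗ pointwise ⟩
  ∑[ i < m ] (δ i a * f i + δ i b * f i + off a b f i)
    ≡⟨ ∑-distrib-+ (λ i → δ i a * f i + δ i b * f i) (off a b f) ⟩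
  ∑[ i < m ] (δ i a * f i + δ i b * f i) + sum (off a b f)
    ≡⟨ cong (_+ sum (off a b f)) (∑-distrib-+ (λ i → δ i a * f i) (λ i → δ i b * f i)) ⟩
  ∑[ i < m ] (δ i a * f i) + ∑[ i < m ] (δ i b * f i) + sum (off a b f)
    ≡⟨ cong (λ t → t + sum (off a b f)) (cong₂ _+_ (sum-δ f a) (sum-δ f b)) ⟩
  f a + f b + sum (off a b f) ∎
  where
  pointwise : ∀ i → f i ≡ δ i a * f i + δ i b * f i + off a b f i
  pointwise i with i ≟ a | i ≟ b
  ... | yes i≡a | yes i≡b = ⊥-elim (a≢b (trans (sym i≡a) i≡b))
  ... | yes _   | no _    = sym (trans (+-identityʳ _) (trans (+-identityʳ _) (+-identityʳ (f i))))
  ... | no _    | yes _   = sym (trans (+-identityʳ _) (+-identityʳ (f i)))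
  ... | no _    | no _    = refl

sum-off-pair : ∀ {m} {a b : Fin m} (f g : Fin m → ℕ) → ¬ a ≡ b →
               (∀ i → ¬ i ≡ a → ¬ i ≡ b → f i ≡ g i) → sum f ≡ sum g →
               f a + f b ≡ g a + g b
sum-off-pair {a = a} {b} f g a≢b agree total = +-cancelʳ-≡ (sum (off a b f)) _ _ (begin
  f a + f b + sum (off a b f) ≡⟨ sym (sum-split-pair a≢b f) ⟩
  sum f                       ≡⟨ total ⟩
  sum g                       ≡⟨ sum-split-pair a≢b g ⟩
  g a + g b + sum (off a b g) ≡⟨ cong (g a + g b +_) (sym (sum-cong-≗ off-agree)) ⟩
  g a + g b + sum (off a b f) ∎)
  where
  off-agree : ∀ i → off a b f i ≡ off a b g i
  off-agree i with i ≟ a | i ≟ b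
  ... | no i≢a | no i≢b = agree i i≢a i≢b
  ... | yes _  | _      = refl
  ... | no _   | yes _  = refl

Fin-pos : ∀ {m} → Fin m → 0 < m
Fin-pos zero    = s≤s z≤n
Fin-pos (suc _) = s≤s z≤n

cancel-pos : ∀ {c x y} → 0 < c → c * x ≡ c * y → x ≡ y
cancel-pos {c} {x} {y} c>0 = *-cancelˡ-≡ x y c {{>-nonZero c>0}}

count-tabulate : ∀ {a p} {A : Set a} {P : A → Set p} (P? : ∀ x → Dec (P x)) m (g : Fin m → A) →
                 length (filter P? (tabulate g)) ≡ ∑[ i < m ] ind (P? (g i))
count-tabulate P? zero    g = refl
count-tabulate P? (suc m) g with P? (g zero)
... | yes _ = cong suc (count-tabulate P? m (g ∘ suc))
... | no _  = count-tabulate P? m (g ∘ suc)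

paths : ∀ {n d} → Coloring n d → Fin n → Fin n → Fin (suc d) → Fin (suc d) → ℕ
paths {n} r x y i j = ∑[ z < n ] (δ (r x z) i * δ (r z y) j)

pcount≡paths : ∀ {n d} (r : Coloring n d) x y i j → pcount r x y i j ≡ paths r x y i j
pcount≡paths {n} r x y i j =
  trans (count-tabulate (λ z → (r x z ≟ i) ×-dec (r z y ≟ j)) n id)
        (sum-cong-≗ (λ z → ind-× (r x z ≟ i) (r z y ≟ j)))

paths-const : ∀ {n d} {r : Coloring n d} → IsAssocScheme r → ∀ {x y x' y'} i j →
              r x y ≡ r x' y' → paths r x y i j ≡ paths r x' y' i j
paths-const {r = r} S {x} {y} {x'} {y'} i j same = begin
  paths r x y i j    ≡⟨ sym (pcount≡paths r x y i j) ⟩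
  pcount r x y i j   ≡⟨ proj₂ p x y same ⟩
  proj₁ p            ≡⟨ sym (proj₂ p x' y' refl) ⟩
  pcount r x' y' i j ≡⟨ pcount≡paths r x' y' i j ⟩
  paths r x' y' i j  ∎
  where
  p : ∃ λ c → ∀ u v → r u v ≡ r x' y' → pcount r u v i j ≡ c
  p = IsAssocScheme.intersection S i j (r x' y')

module Scheme {n d : ℕ} (r : Coloring n d) (S : IsAssocScheme r) where
  open IsAssocScheme S

  Colour : Set
  Colour = Fin (suc d)

  base : Fin n
  base = proj₁ (nonempty zero)

  diag : ∀ x → r x x ≡ zero
  diag x = from (diagonal x x) refl

  tr : Colour → Colour
  tr a = proj₁ (transpose a)

  tr-spec : ∀ a → IsTranspose r a (tr a)
  tr-spec a = proj₂ (transpose a)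

  flip : ∀ {x y a} → r x y ≡ a → r y x ≡ tr a
  flip {x} {y} {a} = to (tr-spec a y x)

  unflip : ∀ {x y a} → r y x ≡ tr a → r x y ≡ a
  unflip {x} {y} {a} = from (tr-spec a y x)

  tr-invol : ∀ a → tr (tr a) ≡ a
  tr-invol a with nonempty a
  ... | x , y , rxy≡a = trans (sym (flip (flip rxy≡a))) rxy≡a

  tr-unique : ∀ {a b} → IsTranspose r a b → b ≡ tr a
  tr-unique {a} t with nonempty a
  ... | x , y , rxy≡a = trans (sym (to (t y x) rxy≡a)) (flip rxy≡a)

  tr-injective : ∀ {a b} → tr a ≡ tr b → a ≡ b
  tr-injective {a} {b} e = trans (sym (tr-invol a)) (trans (cong tr e) (tr-invol b))

  tr-zero : tr zero ≡ zero
  tr-zero = trans (sym (flip (diag base))) (diag base)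

  δ-flip : ∀ x y a → δ (r x y) a ≡ δ (r y x) (tr a)
  δ-flip x y a = ind-cong (r x y ≟ a) (r y x ≟ tr a) flip unflip

  P : Colour → Colour → Colour → ℕ
  P k a b = proj₁ (intersection a b k)

  pcount≡P : ∀ {x y k} a b → r x y ≡ k → pcount r x y a b ≡ P k a b
  pcount≡P {x} {y} a b = proj₂ (intersection a b _) x y

  paths≡P : ∀ {x y k} a b → r x y ≡ k → paths r x y a b ≡ P k a b
  paths≡P {x} {y} a b e = trans (sym (pcount≡paths r x y a b)) (pcount≡P a b e)

  -- p^k_{ab} = p^{k̄}_{b̄ā}: reverse every path.
  P-transpose : ∀ k a b → P k a b ≡ P (tr k) (tr b) (tr a)
  P-transpose k a b with nonempty k
  ... | x , y , rxy≡k = begin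
    P k a b                   ≡⟨ sym (paths≡P a b rxy≡k) ⟩
    paths r x y a b           ≡⟨ sum-cong-≗ reverse ⟩
    paths r y x (tr b) (tr a) ≡⟨ paths≡P (tr b) (tr a) (flip rxy≡k) ⟩
    P (tr k) (tr b) (tr a)    ∎
    where
    reverse : ∀ z → δ (r x z) a * δ (r z y) b ≡ δ (r y z) (tr b) * δ (r z x) (tr a)
    reverse z = trans (cong₂ _*_ (δ-flip x z a) (δ-flip z y b)) (*-comm (δ (r z x) (tr a)) _)

  P-transpose′ : ∀ k a b → P (tr k) a b ≡ P k (tr b) (tr a)
  P-transpose′ k a b = trans (P-transpose (tr k) a b) (cong (λ t → P t (tr b) (tr a)) (tr-invol k))

  val : Colour → ℕ
  val a = P zero a (tr a)

  valency : ∀ x a → ∑[ z < n ] δ (r x z) a ≡ val a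
  valency x a = begin
    ∑[ z < n ] δ (r x z) a            ≡⟨ sum-cong-≗ square ⟩
    paths r x x a (tr a)              ≡⟨ paths≡P a (tr a) (diag x) ⟩
    val a                             ∎
    where
    square : ∀ z → δ (r x z) a ≡ δ (r x z) a * δ (r z x) (tr a)
    square z = sym (trans (cong (δ (r x z) a *_) (sym (δ-flip x z a))) (δ-idem (r x z) a))

  val-pos : ∀ a → 0 < val a
  val-pos a with nonempty a
  ... | x , y , rxy≡a = subst (0 <_) (valency x a)
          (subst (_≤ ∑[ z < n ] δ (r x z) a) (δ-≡ rxy≡a)
                 (term≤sum (λ z → δ (r x z) a) y))

  cancel-val : ∀ k {m m'} → val k * m ≡ val k * m' → m ≡ m'
  cancel-val k = cancel-pos (val-pos k)

  -- val ā = val a: count the pairs of colour a in two ways.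
  val-transpose : ∀ a → val (tr a) ≡ val a
  val-transpose a = sym (cancel-pos (Fin-pos base) (begin
    n * val a                              ≡⟨ sym (sum-const n (val a)) ⟩
    ∑[ x < n ] val a                       ≡⟨ sum-cong-≗ (λ x → sym (valency x a)) ⟩
    ∑[ x < n ] ∑[ z < n ] δ (r x z) a      ≡⟨ ∑-comm (λ x z → δ (r x z) a) ⟩
    ∑[ z < n ] ∑[ x < n ] δ (r x z) a      ≡⟨ sum-cong-≗ (λ z → sum-cong-≗ (λ x → δ-flip x z a)) ⟩
    ∑[ z < n ] ∑[ x < n ] δ (r z x) (tr a) ≡⟨ sum-cong-≗ (λ z → valency z (tr a)) ⟩
    ∑[ z < n ] val (tr a)                  ≡⟨ sum-const n (val (tr a)) ⟩
    n * val (tr a)                         ∎))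

  fibre-sum : ∀ x a (g : Fin n → ℕ) v → (∀ y → r x y ≡ a → g y ≡ v) →
              ∑[ y < n ] (δ (r x y) a * g y) ≡ val a * v
  fibre-sum x a g v const = begin
    ∑[ y < n ] (δ (r x y) a * g y) ≡⟨ sum-cong-≗ on-fibre ⟩
    ∑[ y < n ] (δ (r x y) a * v)   ≡⟨ sym (*-distribʳ-sum v (λ y → δ (r x y) a)) ⟩
    (∑[ y < n ] δ (r x y) a) * v   ≡⟨ cong (_* v) (valency x a) ⟩
    val a * v                      ∎
    where
    on-fibre : ∀ y → δ (r x y) a * g y ≡ δ (r x y) a * v
    on-fibre y with r x y ≟ a
    ... | yes rxy≡a = cong (1 *_) (const y rxy≡a)
    ... | no _      = refl

  -- val c · p^c_{ab} = val a · p^a_{cb̄}: both count triangles (x, y, z) at a fixed x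
  -- with r x y = c, r x z = a and r z y = b.
  P-rotate : ∀ c a b → val c * P c a b ≡ val a * P a c (tr b)
  P-rotate c a b = begin
    val c * P c a b
      ≡⟨ sym (fibre-sum x c (λ y → paths r x y a b) (P c a b) (λ y → paths≡P a b)) ⟩
    ∑[ y < n ] (δ (r x y) c * ∑[ z < n ] (δ (r x z) a * δ (r z y) b))
      ≡⟨ sum-cong-≗ (λ y → *-distribˡ-sum (δ (r x y) c) (λ z → δ (r x z) a * δ (r z y) b)) ⟩
    ∑[ y < n ] ∑[ z < n ] (δ (r x y) c * (δ (r x z) a * δ (r z y) b))
      ≡⟨ ∑-comm (λ y z → δ (r x y) c * (δ (r x z) a * δ (r z y) b)) ⟩
    ∑[ z < n ] ∑[ y < n ] (δ (r x y) c * (δ (r x z) a * δ (r z y) b))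
      ≡⟨ sum-cong-≗ (λ z → trans (sum-cong-≗ (reorder z))
           (sym (*-distribˡ-sum (δ (r x z) a) (λ y → δ (r x y) c * δ (r y z) (tr b))))) ⟩
    ∑[ z < n ] (δ (r x z) a * ∑[ y < n ] (δ (r x y) c * δ (r y z) (tr b)))
      ≡⟨ fibre-sum x a (λ z → paths r x z c (tr b)) (P a c (tr b)) (λ z → paths≡P c (tr b)) ⟩
    val a * P a c (tr b) ∎
    where
    x : Fin n
    x = base
    reorder : ∀ z y → δ (r x y) c * (δ (r x z) a * δ (r z y) b)
                    ≡ δ (r x z) a * (δ (r x y) c * δ (r y z) (tr b))
    reorder z y = begin
      δ (r x y) c * (δ (r x z) a * δ (r z y) b)
        ≡⟨ sym (*-assoc (δ (r x y) c) _ _) ⟩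
      δ (r x y) c * δ (r x z) a * δ (r z y) b
        ≡⟨ cong (_* δ (r z y) b) (*-comm (δ (r x y) c) _) ⟩
      δ (r x z) a * δ (r x y) c * δ (r z y) b
        ≡⟨ *-assoc (δ (r x z) a) _ _ ⟩
      δ (r x z) a * (δ (r x y) c * δ (r z y) b)
        ≡⟨ cong (λ t → δ (r x z) a * (δ (r x y) c * t)) (δ-flip z y b) ⟩
      δ (r x z) a * (δ (r x y) c * δ (r y z) (tr b)) ∎

  colour-sum : ∀ x (g : Colour → ℕ) → ∑[ y < n ] g (r x y) ≡ ∑[ c < suc d ] (val c * g c)
  colour-sum x g = begin
    ∑[ y < n ] g (r x y)
      ≡⟨ sum-cong-≗ (λ y → sym (sum-δ g (r x y))) ⟩
    ∑[ y < n ] ∑[ c < suc d ] (δ c (r x y) * g c)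
      ≡⟨ ∑-comm (λ y c → δ c (r x y) * g c) ⟩
    ∑[ c < suc d ] ∑[ y < n ] (δ c (r x y) * g c)
      ≡⟨ sum-cong-≗ (λ c → sym (*-distribʳ-sum (g c) (λ y → δ c (r x y)))) ⟩
    ∑[ c < suc d ] ((∑[ y < n ] δ c (r x y)) * g c)
      ≡⟨ sum-cong-≗ (λ c → cong (_* g c) (neighbours c)) ⟩
    ∑[ c < suc d ] (val c * g c) ∎
    where
    neighbours : ∀ c → ∑[ y < n ] δ c (r x y) ≡ val c
    neighbours c = trans (sum-cong-≗ (λ y → δ-sym c (r x y))) (valency x c)

  -- Σ_y p_{ab}(x, y) = val a · val b: every a-neighbour z of x has val b b-neighbours.
  paths-total : ∀ x a b → ∑[ y < n ] paths r x y a b ≡ val a * val b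
  paths-total x a b = begin
    ∑[ y < n ] ∑[ z < n ] (δ (r x z) a * δ (r z y) b)
      ≡⟨ ∑-comm (λ y z → δ (r x z) a * δ (r z y) b) ⟩
    ∑[ z < n ] ∑[ y < n ] (δ (r x z) a * δ (r z y) b)
      ≡⟨ sum-cong-≗ (λ z → sym (*-distribˡ-sum (δ (r x z) a) (λ y → δ (r z y) b))) ⟩
    ∑[ z < n ] (δ (r x z) a * ∑[ y < n ] δ (r z y) b)
      ≡⟨ fibre-sum x a (λ z → ∑[ y < n ] δ (r z y) b) (val b) (λ z _ → valency z b) ⟩
    val a * val b ∎

  valency-identity : ∀ a b → ∑[ c < suc d ] (val c * P c a b) ≡ val a * val b
  valency-identity a b = begin
    ∑[ c < suc d ] (val c * P c a b) ≡⟨ sym (colour-sum base (λ c → P c a b)) ⟩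
    ∑[ y < n ] P (r base y) a b      ≡⟨ sum-cong-≗ (λ y → sym (paths≡P {base} {y} a b refl)) ⟩
    ∑[ y < n ] paths r base y a b    ≡⟨ paths-total base a b ⟩
    val a * val b                    ∎

  admissible-criterion : ∀ {e} (f : Colour → Fin (suc e)) →
    (∀ α → (f α ≡ zero ⇔ α ≡ zero)) →
    (s : Fin (suc e) → Colour) → (∀ j → f (s j) ≡ j) →
    (∀ u w → f u ≡ f w → f (tr u) ≡ f (tr w)) →
    Admissible r f
  admissible-criterion f zero-class s section compatible =
    zero-class , (λ j → s j , section j) , λ j → f (tr (s j)) , λ β → mk⇔ (into j β) (outof j β)
    where
    into : ∀ j β → f β ≡ f (tr (s j)) → ∃ λ α → f α ≡ j × IsTranspose r α β
    into j β fβ = tr β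
                , trans (compatible β (tr (s j)) fβ) (trans (cong f (tr-invol (s j))) (section j))
                , subst (IsTranspose r (tr β)) (tr-invol β) (tr-spec (tr β))
    outof : ∀ j β → (∃ λ α → f α ≡ j × IsTranspose r α β) → f β ≡ f (tr (s j))
    outof j β (α , fα≡j , α-β) =
      trans (cong f (tr-unique α-β)) (compatible α (s j) (trans fα≡j (sym (section j))))

  _≁_ : Colour → Colour → Set
  u ≁ a = ¬ u ≡ a × ¬ u ≡ tr a

  ≁-sym : ∀ {u a} → u ≁ a → a ≁ u
  ≁-sym {u} {a} (u≢a , u≢ā) =
    (λ a≡u → u≢a (sym a≡u)) , (λ a≡ū → u≢ā (trans (sym (tr-invol u)) (cong tr (sym a≡ū))))

  ≁-trˡ : ∀ {u a} → u ≁ a → tr u ≁ a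
  ≁-trˡ {u} {a} (u≢a , u≢ā) =
    (λ ū≡a → u≢ā (trans (sym (tr-invol u)) (cong tr ū≡a))) ,
    (λ ū≡ā → u≢a (tr-injective ū≡ā))

  ≁-trʳ : ∀ {u a} → u ≁ a → u ≁ tr a
  ≁-trʳ {u} {a} (u≢a , u≢ā) = u≢ā , (λ u≡a → u≢a (trans u≡a (tr-invol a)))

  classify : ∀ u a → (u ≡ a ⊎ u ≡ tr a) ⊎ u ≁ a
  classify u a with u ≟ a | u ≟ tr a
  ... | yes u≡a | _       = inj₁ (inj₁ u≡a)
  ... | no _    | yes u≡ā = inj₁ (inj₂ u≡ā)
  ... | no u≢a  | no u≢ā  = inj₂ (u≢a , u≢ā)

  record PairFusionFacts (a : Colour) : Set where
    field
      outer : ∀ {u v} → u ≁ a → v ≁ a → P a u v ≡ P (tr a) u v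
      inner : ∀ {u} → u ≁ a → P a a u + P a (tr a) u ≡ P (tr a) a u + P (tr a) (tr a) u

module Merge {e : ℕ} (a b : Fin (suc (suc e))) (a≢b : ¬ a ≡ b) where

  InPair : Fin (suc (suc e)) → Set
  InPair w = w ≡ a ⊎ w ≡ b

  collapse : Fin (suc (suc e)) → Fin (suc (suc e))
  collapse w with w ≟ b
  ... | yes _ = a
  ... | no _  = w

  collapse-fix : ∀ {w} → ¬ w ≡ b → collapse w ≡ w
  collapse-fix {w} w≢b with w ≟ b
  ... | yes w≡b = ⊥-elim (w≢b w≡b)
  ... | no _    = refl

  collapse≢b : ∀ w → ¬ b ≡ collapse w
  collapse≢b w with w ≟ b
  ... | yes _   = λ b≡a → a≢b (sym b≡a)
  ... | no w≢b  = λ b≡w → w≢b (sym b≡w)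

  collapse≡a : ∀ w → collapse w ≡ a ⇔ InPair w
  collapse≡a w = mk⇔ (into w) (outof w)
    where
    into : ∀ w → collapse w ≡ a → InPair w
    into w e with w ≟ b
    ... | yes w≡b = inj₂ w≡b
    ... | no _    = inj₁ e
    outof : ∀ w → InPair w → collapse w ≡ a
    outof w (inj₁ refl) = collapse-fix a≢b
    outof w (inj₂ w≡b) with w ≟ b
    ... | yes _   = refl
    ... | no w≢b  = ⊥-elim (w≢b w≡b)

  collapse≡outside : ∀ {u} → ¬ u ≡ a → ¬ u ≡ b → ∀ w → collapse w ≡ u ⇔ w ≡ u
  collapse≡outside {u} u≢a u≢b w = mk⇔ into (λ { refl → collapse-fix u≢b })
    where
    into : collapse w ≡ u → w ≡ u
    into e with w ≟ b
    ... | yes _ = ⊥-elim (u≢a (sym e))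
    ... | no _  = e

  merge : Fin (suc (suc e)) → Fin (suc e)
  merge w = punchOut (collapse≢b w)

  merge-≡ : ∀ u w → merge u ≡ merge w ⇔ collapse u ≡ collapse w
  merge-≡ u w = mk⇔ (punchOut-injective (collapse≢b u) (collapse≢b w)) (punchOut-cong b)

  merge-pair : ∀ w → merge w ≡ merge a ⇔ InPair w
  merge-pair w = mk⇔
    (λ e → to (collapse≡a w) (trans (to (merge-≡ w a) e) (collapse-fix a≢b)))
    (λ w∈ → from (merge-≡ w a) (trans (from (collapse≡a w) w∈) (sym (collapse-fix a≢b))))

  merge-outside : ∀ {u} → ¬ u ≡ a → ¬ u ≡ b → ∀ w → merge w ≡ merge u ⇔ w ≡ u
  merge-outside {u} u≢a u≢b w = mk⇔
    (λ e → to (collapse≡outside u≢a u≢b w) (trans (to (merge-≡ w u) e) (collapse-fix u≢b)))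
    (λ { refl → refl })

  merge-section : ∀ j → merge (punchIn b j) ≡ j
  merge-section j = trans (punchOut-cong b (collapse-fix (punchInᵢ≢i b j))) (punchOut-punchIn b)

  merge-zero : ¬ zero ≡ b → merge zero ≡ zero
  merge-zero 0≢b =
    trans (punchOut-cong b (collapse-fix 0≢b)) (punchOut-at-zero (λ b≡0 → 0≢b (sym b≡0)))
    where
    punchOut-at-zero : ∀ {i : Fin (suc (suc e))} (i≢0 : ¬ i ≡ zero) → punchOut i≢0 ≡ zero
    punchOut-at-zero {zero}  i≢0 = ⊥-elim (i≢0 refl)
    punchOut-at-zero {suc _} _   = refl

  δ-merge-outside : ∀ {u} → ¬ u ≡ a → ¬ u ≡ b → ∀ w → δ (merge w) (merge u) ≡ δ w u
  δ-merge-outside u≢a u≢b w =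
    ind-cong (merge w ≟ _) (w ≟ _) (to (merge-outside u≢a u≢b w)) (from (merge-outside u≢a u≢b w))

  δ-merge-pair : ∀ w → δ (merge w) (merge a) ≡ δ w a + δ w b
  δ-merge-pair w = ind-⊎ (merge w ≟ merge a) (w ≟ a) (w ≟ b)
    (to (merge-pair w)) (from (merge-pair w)) (λ w≡a w≡b → a≢b (trans (sym w≡a) w≡b))

module PairFusion {n e : ℕ} (r : Coloring n (suc e)) (S : IsAssocScheme r) (Am : Amorphous r)
                  (a : Fin (suc (suc e))) (a≢ā : ¬ a ≡ Scheme.tr r S a) where
  open Scheme r S
  open Merge a (tr a) a≢ā
  open IsAssocScheme S using (nonempty)

  -- The pair {a, ā} is closed under transposition, hence merge respects it.
  InPair-tr : ∀ {w} → InPair w → InPair (tr w)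
  InPair-tr (inj₁ refl) = inj₂ refl
  InPair-tr (inj₂ refl) = inj₁ (tr-invol a)

  merge-compatible : ∀ u w → merge u ≡ merge w → merge (tr u) ≡ merge (tr w)
  merge-compatible u w mu≡mw with classify u a
  ... | inj₂ (u≢a , u≢ā) = sym (cong (merge ∘ tr) (to (merge-outside u≢a u≢ā w) (sym mu≡mw)))
  ... | inj₁ u∈ = trans (from (merge-pair (tr u)) (InPair-tr u∈))
                        (sym (from (merge-pair (tr w)) (InPair-tr w∈)))
    where
    w∈ : InPair w
    w∈ = to (merge-pair w) (trans (sym mu≡mw) (from (merge-pair u) u∈))

  -- 0 is symmetric, so it is not in the non-symmetric pair.
  zero≁a : zero ≁ a
  zero≁a = (λ 0≡a → a≢ā (trans (sym 0≡a) (trans (sym tr-zero) (cong tr 0≡a))))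
         , (λ 0≡ā → a≢ā (trans (sym (tr-invol a)) (trans (cong tr (sym 0≡ā)) (trans tr-zero 0≡ā))))

  merge-admissible : Admissible r merge
  merge-admissible =
    admissible-criterion merge zero-class (punchIn (tr a)) merge-section merge-compatible
    where
    zero-class : ∀ α → (merge α ≡ zero ⇔ α ≡ zero)
    zero-class α = mk⇔
      (λ mα≡0 → to (merge-outside (proj₁ zero≁a) (proj₂ zero≁a) α)
                   (trans mα≡0 (sym (merge-zero (proj₂ zero≁a)))))
      (λ { refl → merge-zero (proj₂ zero≁a) })

  fused : IsAssocScheme (fuse r merge)
  fused = Am e merge merge-admissible

  fused-paths-outside : ∀ {u v} → u ≁ a → v ≁ a → ∀ x y →
    paths (fuse r merge) x y (merge u) (merge v) ≡ paths r x y u v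
  fused-paths-outside (u≢a , u≢ā) (v≢a , v≢ā) x y = sum-cong-≗ λ z →
    cong₂ _*_ (δ-merge-outside u≢a u≢ā (r x z)) (δ-merge-outside v≢a v≢ā (r z y))

  fused-paths-pair : ∀ {u} → u ≁ a → ∀ x y →
    paths (fuse r merge) x y (merge a) (merge u) ≡ paths r x y a u + paths r x y (tr a) u
  fused-paths-pair {u} (u≢a , u≢ā) x y = trans (sum-cong-≗ split)
    (∑-distrib-+ (λ z → δ (r x z) a * δ (r z y) u) (λ z → δ (r x z) (tr a) * δ (r z y) u))
    where
    split : ∀ z → δ (merge (r x z)) (merge a) * δ (merge (r z y)) (merge u)
                ≡ δ (r x z) a * δ (r z y) u + δ (r x z) (tr a) * δ (r z y) u
    split z = trans (cong₂ _*_ (δ-merge-pair (r x z)) (δ-merge-outside u≢a u≢ā (r z y)))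
                    (*-distribʳ-+ (δ (r z y) u) (δ (r x z) a) _)

  -- A pair (x, y) of colour a; its reverse has colour ā, and both have the same fused colour.
  x₀ y₀ : Fin n
  x₀ = proj₁ (nonempty a)
  y₀ = proj₁ (proj₂ (nonempty a))

  colour-a : r x₀ y₀ ≡ a
  colour-a = proj₂ (proj₂ (nonempty a))

  same-fused-colour : fuse r merge x₀ y₀ ≡ fuse r merge y₀ x₀
  same-fused-colour = trans (cong merge colour-a)
    (trans (sym (from (merge-pair (tr a)) (inj₂ refl))) (cong merge (sym (flip colour-a))))

  facts : PairFusionFacts a
  facts = record { outer = outer ; inner = inner }
    where
    outer : ∀ {u v} → u ≁ a → v ≁ a → P a u v ≡ P (tr a) u v
    outer {u} {v} u≁a v≁a = begin
      P a u v                                          ≡⟨ sym (paths≡P u v colour-a) ⟩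
      paths r x₀ y₀ u v                                ≡⟨ sym (fused-paths-outside u≁a v≁a x₀ y₀) ⟩
      paths (fuse r merge) x₀ y₀ (merge u) (merge v)   ≡⟨ paths-const fused _ _ same-fused-colour ⟩
      paths (fuse r merge) y₀ x₀ (merge u) (merge v)   ≡⟨ fused-paths-outside u≁a v≁a y₀ x₀ ⟩
      paths r y₀ x₀ u v                                ≡⟨ paths≡P u v (flip colour-a) ⟩
      P (tr a) u v                                     ∎
    inner : ∀ {u} → u ≁ a → P a a u + P a (tr a) u ≡ P (tr a) a u + P (tr a) (tr a) u
    inner {u} u≁a = begin
      P a a u + P a (tr a) u
        ≡⟨ sym (cong₂ _+_ (paths≡P a u colour-a) (paths≡P (tr a) u colour-a)) ⟩
      paths r x₀ y₀ a u + paths r x₀ y₀ (tr a) u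
        ≡⟨ sym (fused-paths-pair u≁a x₀ y₀) ⟩
      paths (fuse r merge) x₀ y₀ (merge a) (merge u)
        ≡⟨ paths-const fused _ _ same-fused-colour ⟩
      paths (fuse r merge) y₀ x₀ (merge a) (merge u)
        ≡⟨ fused-paths-pair u≁a y₀ x₀ ⟩
      paths r y₀ x₀ a u + paths r y₀ x₀ (tr a) u
        ≡⟨ cong₂ _+_ (paths≡P a u (flip colour-a)) (paths≡P (tr a) u (flip colour-a)) ⟩
      P (tr a) a u + P (tr a) (tr a) u ∎

pair-fusion : ∀ {n d} (r : Coloring n d) (S : IsAssocScheme r) → Amorphous r →
              ∀ a → ¬ a ≡ Scheme.tr r S a → Scheme.PairFusionFacts r S a
pair-fusion {d = zero}  r S Am zero a≢ā = ⊥-elim (a≢ā (sym (Scheme.tr-zero r S)))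
pair-fusion {d = suc e} r S Am a    a≢ā = PairFusion.facts r S Am a a≢ā

module Commutativity {n d : ℕ} (r : Coloring n d) (S : IsAssocScheme r) (Am : Amorphous r) where
  open Scheme r S

  P-outer : ∀ k {u v} → u ≁ k → v ≁ k → P k u v ≡ P (tr k) u v
  P-outer k u≁k v≁k with k ≟ tr k
  ... | yes k≡k̄ = cong (λ t → P t _ _) k≡k̄
  ... | no k≢k̄  = PairFusionFacts.outer (pair-fusion r S Am k k≢k̄) u≁k v≁k

  -- The first lower index a of p^k_{ab} may be replaced by ā when k and b lie
  -- outside {a, ā}: rotate a to the top, use P-outer, rotate back.
  flip-left : ∀ {k a b} → k ≁ a → b ≁ a → P k a b ≡ P k (tr a) b
  flip-left {k} {a} {b} k≁a b≁a = cancel-val k (begin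
    val k * P k a b                ≡⟨ P-rotate k a b ⟩
    val a * P a k (tr b)           ≡⟨ cong (val a *_) (P-outer a k≁a (≁-trˡ b≁a)) ⟩
    val a * P (tr a) k (tr b)      ≡⟨ cong (_* P (tr a) k (tr b)) (sym (val-transpose a)) ⟩
    val (tr a) * P (tr a) k (tr b) ≡⟨ sym (P-rotate k (tr a) b) ⟩
    val k * P k (tr a) b           ∎)

  flip-right : ∀ {k a b} → k ≁ b → a ≁ b → P k a b ≡ P k a (tr b)
  flip-right {k} {a} {b} k≁b a≁b = begin
    P k a b                          ≡⟨ P-transpose k a b ⟩
    P (tr k) (tr b) (tr a)           ≡⟨ flip-left (≁-trʳ (≁-trˡ k≁b)) (≁-trʳ (≁-trˡ a≁b)) ⟩
    P (tr k) (tr (tr b)) (tr a)      ≡⟨ P-transpose′ k (tr (tr b)) (tr a) ⟩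
    P k (tr (tr a)) (tr (tr (tr b))) ≡⟨ cong₂ (P k) (tr-invol a) (cong tr (tr-invol b)) ⟩
    P k a (tr b)                     ∎

  P-swap-tr : ∀ a b → P a (tr a) b ≡ P a b (tr a)
  P-swap-tr a b = cancel-val a (begin
    val a * P a (tr a) b             ≡⟨ P-rotate a (tr a) b ⟩
    val (tr a) * P (tr a) a (tr b)   ≡⟨ cong₂ _*_ (val-transpose a) (P-transpose′ a a (tr b)) ⟩
    val a * P a (tr (tr b)) (tr a)   ≡⟨ cong (λ t → val a * P a t (tr a)) (tr-invol b) ⟩
    val a * P a b (tr a)             ∎)

  comm-apart : ∀ {k a b} → a ≁ b → k ≁ a → k ≁ b → P k a b ≡ P k b a
  comm-apart {k} {a} {b} a≁b k≁a k≁b = sym (begin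
    P k b a                ≡⟨ P-transpose k b a ⟩
    P (tr k) (tr a) (tr b) ≡⟨ sym (P-outer k (≁-trˡ (≁-sym k≁a)) (≁-trˡ (≁-sym k≁b))) ⟩
    P k (tr a) (tr b)      ≡⟨ sym (flip-left k≁a (≁-trˡ (≁-sym a≁b))) ⟩
    P k a (tr b)           ≡⟨ sym (flip-right k≁b a≁b) ⟩
    P k a b                ∎)

  module _ {a b : Colour} (a≁b : a ≁ b) where
    private
      a≁b̄ : tr a ≁ b
      a≁b̄ = ≁-trˡ a≁b

      ā-a-b : P (tr a) a b ≡ P a b (tr a)
      ā-a-b = trans (P-transpose′ a a b) (sym (flip-left a≁b a≁b̄))

      ā-b-a : P (tr a) b a ≡ P a (tr a) b
      ā-b-a = trans (P-transpose′ a b a) (sym (flip-right a≁b a≁b̄))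

      ā-ā-b : P (tr a) (tr a) b ≡ P a b a
      ā-ā-b = begin
        P (tr a) (tr a) b         ≡⟨ P-transpose′ a (tr a) b ⟩
        P a (tr b) (tr (tr a))    ≡⟨ cong (P a (tr b)) (tr-invol a) ⟩
        P a (tr b) a              ≡⟨ sym (flip-left a≁b a≁b) ⟩
        P a b a                   ∎

    -- k = ā needs no fusion beyond P-outer; k = a for symmetric a reduces to it.
    comm-at-tr : P (tr a) a b ≡ P (tr a) b a
    comm-at-tr = trans ā-a-b (trans (sym (P-swap-tr a b)) (sym ā-b-a))

    -- For non-symmetric a this needs the second fusion identity.
    comm-at-self : ¬ a ≡ tr a → P a a b ≡ P a b a
    comm-at-self a≢ā = +-cancelʳ-≡ (P a (tr a) b) _ _ (begin
      P a a b + P a (tr a) b              ≡⟨ PairFusionFacts.inner (pair-fusion r S Am a a≢ā) (≁-sym a≁b) ⟩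
      P (tr a) a b + P (tr a) (tr a) b    ≡⟨ cong₂ _+_ ā-a-b ā-ā-b ⟩
      P a b (tr a) + P a b a              ≡⟨ +-comm (P a b (tr a)) _ ⟩
      P a b a + P a b (tr a)              ≡⟨ cong (P a b a +_) (sym (P-swap-tr a b)) ⟩
      P a b a + P a (tr a) b              ∎)

    comm-in-class : ∀ {k} → k ≡ a ⊎ k ≡ tr a → P k a b ≡ P k b a
    comm-in-class (inj₂ refl) = comm-at-tr
    comm-in-class (inj₁ refl) with a ≟ tr a
    ... | yes a≡ā = subst (λ t → P t a b ≡ P t b a) (sym a≡ā) comm-at-tr
    ... | no a≢ā  = comm-at-self a≢ā

  comm-tr-outside : ∀ {k a} → k ≁ a → P k a (tr a) ≡ P k (tr a) a
  comm-tr-outside {k} {a} k≁a = cancel-val k (begin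
    val k * P k a (tr a)             ≡⟨ P-rotate k a (tr a) ⟩
    val a * P a k (tr (tr a))        ≡⟨ cong (λ t → val a * P a k t) (tr-invol a) ⟩
    val a * P a k a                  ≡⟨ cong (val a *_) (sym (comm-in-class (≁-sym k≁a) (inj₁ refl))) ⟩
    val a * P a a k                  ≡⟨ cong (val a *_) (flip-right (≁-sym k≁a) (≁-sym k≁a)) ⟩
    val a * P a a (tr k)             ≡⟨ cong (λ t → val a * P a t (tr k)) (sym (tr-invol a)) ⟩
    val a * P a (tr (tr a)) (tr k)   ≡⟨ cong₂ _*_ (sym (val-transpose a)) (sym (P-transpose′ a k (tr a))) ⟩
    val (tr a) * P (tr a) k (tr a)   ≡⟨ sym (P-rotate k (tr a) a) ⟩
    val k * P k (tr a) a             ∎)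

  -- Weighting by valencies, the sums Σ_c val c · p^c_{aā} and Σ_c val c · p^c_{āa}
  -- agree, and so do all their terms with c outside {a, ā}.
  comm-tr-self : ∀ {a} → ¬ a ≡ tr a → P a a (tr a) ≡ P a (tr a) a
  comm-tr-self {a} a≢ā = cancel-pos (<-≤-trans (val-pos a) (m≤m+n (val a) _)) (begin
    (val a + val (tr a)) * X             ≡⟨ *-distribʳ-+ X (val a) _ ⟩
    val a * X + val (tr a) * X           ≡⟨ cong (λ t → val a * X + val (tr a) * t) (sym ā-a-ā) ⟩
    val a * X + val (tr a) * P (tr a) a (tr a)
      ≡⟨ sum-off-pair (λ c → val c * P c a (tr a)) (λ c → val c * P c (tr a) a) a≢ā off-pair totals ⟩
    val a * Y + val (tr a) * P (tr a) (tr a) a ≡⟨ cong (λ t → val a * Y + val (tr a) * t) ā-ā-a ⟩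
    val a * Y + val (tr a) * Y           ≡⟨ sym (*-distribʳ-+ Y (val a) _) ⟩
    (val a + val (tr a)) * Y             ∎)
    where
    X Y : ℕ
    X = P a a (tr a)
    Y = P a (tr a) a
    ā-a-ā : P (tr a) a (tr a) ≡ X
    ā-a-ā = trans (P-transpose′ a a (tr a)) (cong (λ t → P a t (tr a)) (tr-invol a))
    ā-ā-a : P (tr a) (tr a) a ≡ Y
    ā-ā-a = trans (P-transpose′ a (tr a) a) (cong (P a (tr a)) (tr-invol a))
    off-pair : ∀ c → ¬ c ≡ a → ¬ c ≡ tr a → val c * P c a (tr a) ≡ val c * P c (tr a) a
    off-pair c c≢a c≢ā = cong (val c *_) (comm-tr-outside (c≢a , c≢ā))
    totals : ∑[ c < suc d ] (val c * P c a (tr a)) ≡ ∑[ c < suc d ] (val c * P c (tr a) a)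
    totals = trans (valency-identity a (tr a))
               (trans (*-comm (val a) _) (sym (valency-identity (tr a) a)))

  comm-tr : ∀ k a → P k a (tr a) ≡ P k (tr a) a
  comm-tr k a with a ≟ tr a
  ... | yes a≡ā = subst (λ t → P k a t ≡ P k t a) a≡ā refl
  ... | no a≢ā with classify k a
  ...   | inj₂ k≁a       = comm-tr-outside k≁a
  ...   | inj₁ (inj₁ refl) = comm-tr-self a≢ā
  ...   | inj₁ (inj₂ refl) = begin
    P (tr a) a (tr a)           ≡⟨ P-transpose′ a a (tr a) ⟩
    P a (tr (tr a)) (tr a)      ≡⟨ cong (λ t → P a t (tr a)) (tr-invol a) ⟩
    P a a (tr a)                ≡⟨ comm-tr-self a≢ā ⟩
    P a (tr a) a                ≡⟨ cong (P a (tr a)) (sym (tr-invol a)) ⟩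
    P a (tr a) (tr (tr a))      ≡⟨ sym (P-transpose′ a (tr a) a) ⟩
    P (tr a) (tr a) a           ∎

  P-comm : ∀ k a b → P k a b ≡ P k b a
  P-comm k a b with classify b a
  ... | inj₁ (inj₁ refl) = refl
  ... | inj₁ (inj₂ refl) = comm-tr k a
  ... | inj₂ b≁a with classify k a
  ...   | inj₁ k∈a = comm-in-class (≁-sym b≁a) k∈a
  ...   | inj₂ k≁a with classify k b
  ...     | inj₁ k∈b = sym (comm-in-class b≁a k∈b)
  ...     | inj₂ k≁b = comm-apart (≁-sym b≁a) k≁a k≁b

mainTheorem4 : ∀ (n d : ℕ) → 2 ≤ n → (r : Coloring n d) →
    IsAssocScheme r → NonSymmetric r → Amorphous r → Commutative r
mainTheorem4 n d _ r S _ Am i j k x y rxy≡k = begin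
  pcount r x y i j ≡⟨ pcount≡P i j rxy≡k ⟩
  P k i j          ≡⟨ P-comm k i j ⟩
  P k j i          ≡⟨ sym (pcount≡P j i rxy≡k) ⟩
  pcount r x y j i ∎
  where
  open Scheme r S
  open Commutativity r S Am
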